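{- Let $a=a_1\cdots a_r$ be a nonempty word of distinct positive integers, let $\kappa_1$ be its largest letter, and write $a=a_L\,\kappa_1\,a_R$ where $a_L,a_R$ are the subwords to the left and right of $\kappa_1$. Let $\mathbf B_L,\mathbf B_R\in\mathcal L^I$ with $\mathbf B_L=_{\mathcal I}f(a_L)$ (when $a_L\neq\emptyset$) and $\mathbf B_R=_{\mathcal I}f(a_R)$ (when $a_R\ne\emptyset$). Then: if $a_L,a_R\ne\emptyset$, $f(a)=_{\mathcal I}(\mathbf 2^{\kappa_1}\circ_2\mathbf B_R)\circ_1\mathbf B_L$; if $a_L=\emptyset\ne a_R$, $f(a)=_{\mathcal I}\mathbf 2^{\kappa_1}\circ_2\mathbf B_R$; if $a_R=\emptyset\neq a_L$, $f(a)=_{\mathcal I}\mathbf 2^{\kappa_1}\circ_1\mathbf B_L$; and if $a=\kappa_1$, $f(a)=\mathbf 2^{\kappa_1}$.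
   Context: Indexed terms: $\mathcal L^I$ is generated by symbols $\mathbf 2^k$ ($k$ a positive integer) of arity $2$, and for terms $\mathbf A,\mathbf B$ and $1\le m\le|\mathbf A|$ the term $\mathbf A\circ_m\mathbf B$ of arity $|\mathbf A|+|\mathbf B|-1$; no index occurs more than once. $=_{\mathcal I}$ is the smallest congruence on $\mathcal L^I$ containing all instances of (assoc1) $(\mathbf A\circ_n\mathbf B)\circ_m\mathbf C=\mathbf A\circ_n(\mathbf B\circ_{m-n+1}\mathbf C)$ if $n\le m<n+|\mathbf B|$, and (assoc2) $(\mathbf A\circ_n\mathbf B)\circ_m\mathbf C=(\mathbf A\circ_{m-|\mathbf B|+1}\mathbf C)\circ_n\mathbf B$ if $n+|\mathbf B|\le m$. Decreasing encoding: for a nonempty word $a=a_1\cdots a_r$ of distinct positive integers, let $\kappa_1>\cdots>\kappa_r$ be its letters in decreasing order, and for a letter $x$ of $a$ let $u_a(x)$ be the number of letters of $a$ to the left of $x$ that are greater than $x$. Then $f(a)=\mathbf 2^{\kappa_1}$ if $r=1$, and otherwise $f(a)=(\cdots((\mathbf 2^{\kappa_1}\circ_{m_2}\mathbf 2^{\kappa_2})\circ_{m_3}\mathbf 2^{\kappa_3})\cdots)\circ_{m_r}\mathbf 2^{\kappa_r}$ with $m_q=u_a(\kappa_q)+1$. -}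

module Defs where

open import Data.Nat using (ℕ; zero; suc; _+_; _∸_; _≤_; _<_; _<ᵇ_; _≡ᵇ_)
open import Data.Bool using (Bool; true; false; if_then_else_)
open import Data.List using (List; []; _∷_; _++_; foldl)
open import Data.List.Relation.Unary.Unique.Propositional using (Unique)
open import Data.Product using (_×_)

infixl 6 _∘[_]_

data Term : Set where
  two    : ℕ → Term
  _∘[_]_ : Term → ℕ → Term → Term

ar : Term → ℕ
ar (two k)       = 2
ar (A ∘[ m ] B)  = ar A + ar B ∸ 1

idx : Term → List ℕ
idx (two k)      = k ∷ []
idx (A ∘[ m ] B) = idx A ++ idx B

Valid : Term → Set
Valid (two k)      = 1 ≤ k
Valid (A ∘[ m ] B) = Valid A × Valid B × 1 ≤ m × m ≤ ar A

WF : Term → Set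
WF T = Valid T × Unique (idx T)

infix 4 _≈I_

data _≈I_ : Term → Term → Set where
  ≈refl  : ∀ {A} → WF A → A ≈I A
  ≈sym   : ∀ {A B} → A ≈I B → B ≈I A
  ≈trans : ∀ {A B C} → A ≈I B → B ≈I C → A ≈I C
  ≈cong  : ∀ {A A' B B' m} → A ≈I A' → B ≈I B' →
           WF (A ∘[ m ] B) → WF (A' ∘[ m ] B') →
           A ∘[ m ] B ≈I A' ∘[ m ] B'
  assoc1 : ∀ {A B C n m} → WF ((A ∘[ n ] B) ∘[ m ] C) →
           n ≤ m → m < n + ar B →
           (A ∘[ n ] B) ∘[ m ] C ≈I A ∘[ n ] (B ∘[ m ∸ n + 1 ] C)
  assoc2 : ∀ {A B C n m} → WF ((A ∘[ n ] B) ∘[ m ] C) →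
           n + ar B ≤ m →
           (A ∘[ n ] B) ∘[ m ] C ≈I (A ∘[ m ∸ ar B + 1 ] C) ∘[ n ] B

insertDesc : ℕ → List ℕ → List ℕ
insertDesc x []       = x ∷ []
insertDesc x (y ∷ ys) = if y <ᵇ x then x ∷ y ∷ ys else y ∷ insertDesc x ys

sortDesc : List ℕ → List ℕ
sortDesc []       = []
sortDesc (x ∷ xs) = insertDesc x (sortDesc xs)

-- u_a(x): number of letters of a to the left of x that are greater than x
u : List ℕ → ℕ → ℕ
u []       x = 0
u (y ∷ ys) x = if y ≡ᵇ x then 0 else ((if x <ᵇ y then 1 else 0) + u ys x)

-- f(a); the value on the empty word is a dummy (f is only used on nonempty words)
f : List ℕ → Term
f a with sortDesc a
... | []      = two 0
... | κ ∷ κs  = foldl (λ T κq → T ∘[ u a κq + 1 ] two κq) (two κ) κs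

-- The least letter z of a word is grafted last by f, at position 1 + (number of letters to
-- its left), and removing it changes neither the order nor the u-values of the other
-- letters; hence f (P ++ z ∷ Q) = f (P ++ Q) ∘[ 1 + |P| ] 2^z.  So we induct on |aL ++ aR|,
-- removing the least letter: if it lies in aL, (assoc1) moves its graft into the left
-- subterm f aL; if it lies in aR, (assoc2) moves the graft past f aL and (assoc1) then into
-- the right subterm f aR.  Well-formedness is carried along because =_I preserves the
-- multiset of indices, and with it the arity ar T = 1 + (number of indices).
module Submission where

open import Defs
open import Data.Bool using (true; false)
open import Data.List using (List; []; _∷_; _++_; length; foldl; [_])
open import Data.List.Extrema.Nat using (min; argmin-sel; min≤⊤; min≤xs)
open import Data.List.Membership.Propositional using (_∈_)
open import Data.List.Membership.Propositional.Properties using (∈-++⁻; ∈-∃++)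
open import Data.List.Properties
  using (length-++; length-++-≤ˡ; ++-assoc; ++-identityʳ; foldl-++)
open import Data.List.Relation.Binary.Permutation.Propositional
  using (_↭_; ↭-refl; ↭-sym; ↭-trans; ↭-prep; ↭-swap; ↭-reflexive; ↭⇒↭ₛ)
open import Data.List.Relation.Binary.Permutation.Propositional.Properties
  using (↭-length; ↭-empty-inv; All-resp-↭; ++⁺; ++⁺ˡ; ++⁺ʳ; ++-comm; shift)
import Data.List.Relation.Binary.Permutation.Setoid.Properties as Permutationₛ
open import Data.List.Relation.Unary.All as All using (All; []; _∷_)
import Data.List.Relation.Unary.All.Properties as All
open import Data.List.Relation.Unary.Any using (here; there)
open import Data.List.Relation.Unary.Unique.Propositional using (Unique; []; _∷_)
open import Data.Maybe using (Maybe; nothing; just)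
open import Data.Nat using (ℕ; zero; suc; _+_; _∸_; _≤_; _<_; _<ᵇ_; _<?_; _≟_; s≤s; z≤n)
open import Data.Nat.Properties
  using ( +-comm; +-suc; +-identityʳ; +-∸-comm; m+n∸m≡n; m≤n+o⇒m∸n≤o; m≤n+m; m≤m+n
        ; ≤-trans; +-monoʳ-≤; +-monoʳ-<; suc-injective; <⇒≢; >⇒≢; <⇒≯; ≤∧≢⇒<)
open import Data.Product using (_×_; _,_; proj₁; proj₂; ∃-syntax; ∃₂; uncurry)
open import Data.Sum using (inj₁; inj₂; [_,_]′)
open import Function using (id)
open import Relation.Binary.PropositionalEquality
  using (_≡_; _≢_; refl; sym; trans; cong; cong₂; subst; subst₂; setoid; module ≡-Reasoning)
open import Relation.Nullary using (contradiction)
open import Relation.Nullary.Decidable using (dec-true; dec-false)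

private
  variable
    A A′ B B′ C S T : Term
    M M′ : Maybe Term
    k m n z : ℕ

Unique-resp-↭ : ∀ {xs ys : List ℕ} → xs ↭ ys → Unique xs → Unique ys
Unique-resp-↭ p = Permutationₛ.Unique-resp-↭ (setoid ℕ) (↭⇒↭ₛ p)

Unique-++⁻ : ∀ (xs : List ℕ) {ys} → Unique (xs ++ ys) → Unique xs × Unique ys
Unique-++⁻ []       u          = [] , u
Unique-++⁻ (x ∷ xs) (x∉ ∷ u) with uxs , uys ← Unique-++⁻ xs u = All.++⁻ˡ xs x∉ ∷ uxs , uys

++-swap-↭ : ∀ (xs ys zs : List ℕ) → (xs ++ ys) ++ zs ↭ (xs ++ zs) ++ ys
++-swap-↭ xs ys zs = ↭-trans (↭-reflexive (++-assoc xs ys zs))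
  (↭-trans (++⁺ˡ xs (++-comm ys zs)) (↭-reflexive (sym (++-assoc xs zs ys))))

All-insert : ∀ {P : ℕ → Set} xs {y ys} → P y → All P (xs ++ ys) → All P (xs ++ y ∷ ys)
All-insert xs py pxs with pxs₁ , pxs₂ ← All.++⁻ xs pxs = All.++⁺ pxs₁ (py ∷ pxs₂)

least : ∀ {ws : List ℕ} → length ws ≡ suc n → ∃[ z ] z ∈ ws × All (z ≤_) ws
least {ws = x ∷ xs} _ =
  min x xs , [ here , there ]′ (argmin-sel id x xs) , min≤⊤ x xs ∷ min≤xs x xs

m+n∸m+1≡1+n : ∀ m n → m + n ∸ m + 1 ≡ suc n
m+n∸m+1≡1+n m n = trans (cong (_+ 1) (m+n∸m≡n m n)) (+-comm n 1)

m<n+o⇒m∸n+1≤o : ∀ {m n o} → n ≤ m → m < n + o → m ∸ n + 1 ≤ o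
m<n+o⇒m∸n+1≤o {m} {n} {o} n≤m m<n+o =
  subst (_≤ o) (+-∸-comm 1 n≤m) (m≤n+o⇒m∸n≤o (m + 1) n (subst (_≤ n + o) (+-comm 1 m) m<n+o))

-- Invariants of =_I

ar-idx : ∀ T → ar T ≡ suc (length (idx T))
ar-idx (two k)      = refl
ar-idx (A ∘[ m ] B)
  rewrite ar-idx A | ar-idx B | length-++ (idx A) {idx B} = +-suc _ _

ar-∘ : ∀ A m B → suc (ar (A ∘[ m ] B)) ≡ ar A + ar B
ar-∘ A m B rewrite ar-idx A | ar-idx B = refl

ar-∘ˡ-≤ : ∀ A m B → ar A ≤ ar (A ∘[ m ] B)
ar-∘ˡ-≤ A m B =
  subst₂ _≤_ (sym (ar-idx A)) (sym (ar-idx (A ∘[ m ] B))) (s≤s (length-++-≤ˡ (idx A)))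

idx-≈I : A ≈I B → idx A ↭ idx B
idx-≈I (≈refl _)                  = ↭-refl
idx-≈I (≈sym p)                   = ↭-sym (idx-≈I p)
idx-≈I (≈trans p q)               = ↭-trans (idx-≈I p) (idx-≈I q)
idx-≈I (≈cong p q _ _)            = ++⁺ (idx-≈I p) (idx-≈I q)
idx-≈I (assoc1 {A} {B} {C} _ _ _) = ↭-reflexive (++-assoc (idx A) (idx B) (idx C))
idx-≈I (assoc2 {A} {B} {C} _ _)   = ++-swap-↭ (idx A) (idx B) (idx C)

ar-≈I : A ≈I B → ar A ≡ ar B
ar-≈I {A} {B} p = trans (ar-idx A) (trans (cong suc (↭-length (idx-≈I p))) (sym (ar-idx B)))

assoc1-WF : WF ((A ∘[ n ] B) ∘[ m ] C) → n ≤ m → m < n + ar B →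
            WF (A ∘[ n ] (B ∘[ m ∸ n + 1 ] C))
assoc1-WF {A} {n} {B} {m} {C} (((vA , vB , 1≤n , n≤A) , vC , _) , u) n≤m m<n+B =
  (vA , (vB , vC , m≤n+m 1 (m ∸ n) , m<n+o⇒m∸n+1≤o n≤m m<n+B) , 1≤n , n≤A) ,
  subst Unique (++-assoc (idx A) (idx B) (idx C)) u

assoc2-WF : WF ((A ∘[ n ] B) ∘[ m ] C) → n + ar B ≤ m →
            WF ((A ∘[ m ∸ ar B + 1 ] C) ∘[ n ] B)
assoc2-WF {A} {n} {B} {m} {C} (((vA , vB , 1≤n , n≤A) , vC , _ , m≤AB) , u) n+B≤m =
  ((vA , vC , m≤n+m 1 (m ∸ ar B) , m<n+o⇒m∸n+1≤o (≤-trans (m≤n+m (ar B) n) n+B≤m) m<B+A) ,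
   vB , 1≤n , ≤-trans n≤A (ar-∘ˡ-≤ A (m ∸ ar B + 1) C)) ,
  Unique-resp-↭ (++-swap-↭ (idx A) (idx B) (idx C)) u
  where
  m<B+A : m < ar B + ar A
  m<B+A = subst (m <_) (trans (ar-∘ A n B) (+-comm (ar A) (ar B))) (s≤s m≤AB)

≈I-WF : A ≈I B → WF A × WF B
≈I-WF (≈refl w)            = w , w
≈I-WF (≈sym p)             = proj₂ (≈I-WF p) , proj₁ (≈I-WF p)
≈I-WF (≈trans p q)         = proj₁ (≈I-WF p) , proj₂ (≈I-WF q)
≈I-WF (≈cong _ _ w w′)     = w , w′
≈I-WF (assoc1 w n≤m m<n+B) = w , assoc1-WF w n≤m m<n+B
≈I-WF (assoc2 w n+B≤m)     = w , assoc2-WF w n+B≤m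

≈trans′ : A ≈I B → (WF B → B ≈I C) → A ≈I C
≈trans′ p q = ≈trans p (q (proj₂ (≈I-WF p)))

WF-∘ˡ : WF (A ∘[ m ] B) → WF A
WF-∘ˡ {A} ((vA , _) , u) = vA , proj₁ (Unique-++⁻ (idx A) u)

WF-∘ʳ : WF (A ∘[ m ] B) → WF B
WF-∘ʳ {A} ((_ , vB , _) , u) = vB , proj₂ (Unique-++⁻ (idx A) u)

∘-cong : A ≈I A′ → B ≈I B′ → WF (A ∘[ m ] B) → A ∘[ m ] B ≈I A′ ∘[ m ] B′
∘-cong {m = m} p q w@((_ , _ , 1≤m , m≤A) , u) = ≈cong p q w
  ((proj₁ (proj₂ (≈I-WF p)) , proj₁ (proj₂ (≈I-WF q)) , 1≤m , subst (m ≤_) (ar-≈I p) m≤A) ,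
   Unique-resp-↭ (++⁺ (idx-≈I p) (idx-≈I q)) u)

∘-congˡ : A ≈I A′ → WF (A ∘[ m ] B) → A ∘[ m ] B ≈I A′ ∘[ m ] B
∘-congˡ p w = ∘-cong p (≈refl (WF-∘ʳ w)) w

∘-congʳ : B ≈I B′ → WF (A ∘[ m ] B) → A ∘[ m ] B ≈I A ∘[ m ] B′
∘-congʳ q w = ∘-cong (≈refl (WF-∘ˡ w)) q w

graft-WF : WF T → 1 ≤ z → 1 ≤ m → m ≤ ar T → All (z ≢_) (idx T) → WF (T ∘[ m ] two z)
graft-WF {T} {z} (vT , uT) 1≤z 1≤m m≤T z∉T =
  (vT , 1≤z , 1≤m , m≤T) , Unique-resp-↭ (++-comm [ z ] (idx T)) (z∉T ∷ uT)

-- Terms with an optional argument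

-- nothing plays the role of an identity operation of arity 1, so that an empty aL or aR
-- needs no case of its own.
infixl 6 _∘?[_]_ _?∘[_]_

_∘?[_]_ : Term → ℕ → Maybe Term → Term
A ∘?[ m ] nothing = A
A ∘?[ m ] just B  = A ∘[ m ] B

_?∘[_]_ : Maybe Term → ℕ → Term → Term
nothing ?∘[ m ] B = B
just A  ?∘[ m ] B = A ∘[ m ] B

ar? : Maybe Term → ℕ
ar? nothing  = 1
ar? (just A) = ar A

WF-∘?ˡ : WF (A ∘?[ n ] M) → WF A
WF-∘?ˡ {M = nothing} w = w
WF-∘?ˡ {M = just _}  w = WF-∘ˡ w

∘?-congˡ : A ≈I A′ → WF (A ∘?[ n ] M) → A ∘?[ n ] M ≈I A′ ∘?[ n ] M
∘?-congˡ {M = nothing} p _ = p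
∘?-congˡ {M = just _}  p w = ∘-congˡ p w

assoc1? : k < ar? M → WF ((A ∘?[ n ] M) ∘[ n + k ] C) →
          (A ∘?[ n ] M) ∘[ n + k ] C ≈I A ∘[ n ] (M ?∘[ suc k ] C)
assoc1? {zero}  {nothing} {n = n} _ w rewrite +-identityʳ n = ≈refl w
assoc1? {suc _} {nothing} (s≤s ()) _
assoc1? {k}     {just B} {A} {n} {C} k<B w =
  subst (λ j → (A ∘[ n ] B) ∘[ n + k ] C ≈I A ∘[ n ] (B ∘[ j ] C)) (m+n∸m+1≡1+n n k)
        (assoc1 w (m≤m+n n k) (+-monoʳ-< n k<B))

assoc2? : n ≤ k → WF ((A ∘?[ n ] M) ∘[ ar? M + k ] C) →
          (A ∘?[ n ] M) ∘[ ar? M + k ] C ≈I (A ∘[ suc k ] C) ∘?[ n ] M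
assoc2? {M = nothing} _ w = ≈refl w
assoc2? {n} {k} {A} {just B} {C} n≤k w =
  subst (λ j → (A ∘[ n ] B) ∘[ ar B + k ] C ≈I (A ∘[ j ] C) ∘[ n ] B) (m+n∸m+1≡1+n (ar B) k)
        (assoc2 w (subst (_≤ ar B + k) (+-comm (ar B) n) (+-monoʳ-≤ (ar B) n≤k)))

graft-right : m ≡ ar? M′ + suc k → k < ar? M → WF (((A ∘?[ 2 ] M) ∘?[ 1 ] M′) ∘[ m ] C) →
              ((A ∘?[ 2 ] M) ∘?[ 1 ] M′) ∘[ m ] C ≈I (A ∘[ 2 ] (M ?∘[ suc k ] C)) ∘?[ 1 ] M′
graft-right refl k<M w =
  ≈trans′ (assoc2? (s≤s z≤n) w) (λ w′ → ∘?-congˡ (assoc1? k<M (WF-∘?ˡ w′)) w′)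

-- The decreasing encoding

u-insert-smaller : ∀ P {z Q x} → z < x → u (P ++ z ∷ Q) x ≡ u (P ++ Q) x
u-insert-smaller []      {z} {Q} {x} z<x
  rewrite dec-false (z ≟ x) (<⇒≢ z<x) | dec-false (x <? z) (<⇒≯ z<x) = refl
u-insert-smaller (y ∷ P) {z} {Q} {x} z<x rewrite u-insert-smaller P {z} {Q} {x} z<x = refl

u-min : ∀ P {z Q} → All (z <_) P → u (P ++ z ∷ Q) z ≡ length P
u-min []      {z} _ rewrite dec-true (z ≟ z) refl = refl
u-min (y ∷ P) {z} (z<y ∷ z<P)
  rewrite dec-false (y ≟ z) (>⇒≢ z<y) | dec-true (z <? y) z<y = cong suc (u-min P z<P)

insertDesc-↭ : ∀ x l → insertDesc x l ↭ x ∷ l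
insertDesc-↭ x []      = ↭-refl
insertDesc-↭ x (y ∷ l) with y <ᵇ x
... | true  = ↭-refl
... | false = ↭-trans (↭-prep y (insertDesc-↭ x l)) (↭-swap y x ↭-refl)

sortDesc-↭ : ∀ l → sortDesc l ↭ l
sortDesc-↭ []      = ↭-refl
sortDesc-↭ (x ∷ l) = ↭-trans (insertDesc-↭ x (sortDesc l)) (↭-prep x (sortDesc-↭ l))

sortDesc-∷ : ∀ w → w ≢ [] → ∃₂ λ κ κs → sortDesc w ≡ κ ∷ κs
sortDesc-∷ w w≢[] with sortDesc w in eq
... | []     = contradiction (↭-empty-inv (↭-sym (subst (_↭ w) eq (sortDesc-↭ w)))) w≢[]
... | κ ∷ κs = κ , κs , refl

insertDesc-min : ∀ l → All (z <_) l → insertDesc z l ≡ l ++ [ z ]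
insertDesc-min     []      []          = refl
insertDesc-min {z} (y ∷ l) (z<y ∷ z<l)
  rewrite dec-false (y <? z) (<⇒≯ z<y) = cong (y ∷_) (insertDesc-min l z<l)

insertDesc-∷ʳ : ∀ {y} l → z < y → insertDesc y (l ++ [ z ]) ≡ insertDesc y l ++ [ z ]
insertDesc-∷ʳ {z} {y} []      z<y rewrite dec-true (z <? y) z<y = refl
insertDesc-∷ʳ {y = y} (w ∷ l) z<y with w <ᵇ y
... | true  = refl
... | false = cong (w ∷_) (insertDesc-∷ʳ l z<y)

sortDesc-min : ∀ P Q → All (z <_) (P ++ Q) → sortDesc (P ++ z ∷ Q) ≡ sortDesc (P ++ Q) ++ [ z ]
sortDesc-min []      Q z<Q = insertDesc-min (sortDesc Q) (All-resp-↭ (↭-sym (sortDesc-↭ Q)) z<Q)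
sortDesc-min (y ∷ P) Q (z<y ∷ z<P++Q)
  rewrite sortDesc-min P Q z<P++Q = insertDesc-∷ʳ (sortDesc (P ++ Q)) z<y

graft : List ℕ → Term → ℕ → Term
graft a T x = T ∘[ u a x + 1 ] two x

f-sorted : ∀ a {κ κs} → sortDesc a ≡ κ ∷ κs → f a ≡ foldl (graft a) (two κ) κs
f-sorted a eq rewrite eq = refl

foldl-graft-cong : ∀ a b T xs → All (λ x → u a x ≡ u b x) xs →
                   foldl (graft a) T xs ≡ foldl (graft b) T xs
foldl-graft-cong a b T []       []            = refl
foldl-graft-cong a b T (x ∷ xs) (uax≡ubx ∷ h)
  rewrite uax≡ubx = foldl-graft-cong a b (graft b T x) xs h

idx-foldl-graft : ∀ a T xs → idx (foldl (graft a) T xs) ≡ idx T ++ xs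
idx-foldl-graft a T []       = sym (++-identityʳ (idx T))
idx-foldl-graft a T (x ∷ xs) =
  trans (idx-foldl-graft a (graft a T x) xs) (++-assoc (idx T) [ x ] xs)

f-idx : ∀ w → w ≢ [] → idx (f w) ↭ w
f-idx w w≢[] with κ , κs , eq ← sortDesc-∷ w w≢[] =
  subst (_↭ w) (sym (trans (cong idx (f-sorted w eq)) (idx-foldl-graft w (two κ) κs)))
        (subst (_↭ w) eq (sortDesc-↭ w))

f-ar : ∀ w → w ≢ [] → ar (f w) ≡ suc (length w)
f-ar w w≢[] = trans (ar-idx (f w)) (cong suc (↭-length (f-idx w w≢[])))

f-insert-min : ∀ P Q → P ++ Q ≢ [] → All (z <_) (P ++ Q) →
               f (P ++ z ∷ Q) ≡ f (P ++ Q) ∘[ suc (length P) ] two z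
f-insert-min {z} P Q P++Q≢[] z< with κ , κs , eq ← sortDesc-∷ (P ++ Q) P++Q≢[] = begin
  f w
    ≡⟨ f-sorted w sorted ⟩
  foldl (graft w) (two κ) (κs ++ [ z ])
    ≡⟨ foldl-++ (graft w) (two κ) κs [ z ] ⟩
  graft w (foldl (graft w) (two κ) κs) z
    ≡⟨ cong₂ (λ T k → T ∘[ k ] two z) same-prefix position ⟩
  foldl (graft w′) (two κ) κs ∘[ suc (length P) ] two z
    ≡⟨ cong (_∘[ suc (length P) ] two z) (sym (f-sorted w′ eq)) ⟩
  f w′ ∘[ suc (length P) ] two z
    ∎
  where
  open ≡-Reasoning
  w w′ : List ℕ
  w  = P ++ z ∷ Q
  w′ = P ++ Q
  sorted : sortDesc w ≡ κ ∷ κs ++ [ z ]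
  sorted = trans (sortDesc-min P Q z<) (cong (_++ [ z ]) eq)
  z<κs : All (z <_) κs
  z<κs = All.tail (subst (All _) eq (All-resp-↭ (↭-sym (sortDesc-↭ w′)) z<))
  same-prefix : foldl (graft w) (two κ) κs ≡ foldl (graft w′) (two κ) κs
  same-prefix = foldl-graft-cong w w′ (two κ) κs (All.map (u-insert-smaller P) z<κs)
  position : u w z + 1 ≡ suc (length P)
  position = trans (cong (_+ 1) (u-min P (All.++⁻ˡ P z<))) (+-comm (length P) 1)

f? : List ℕ → Maybe Term
f? []      = nothing
f? (x ∷ w) = just (f (x ∷ w))

ar?-f? : ∀ w → ar? (f? w) ≡ suc (length w)
ar?-f? []      = refl
ar?-f? (x ∷ w) = f-ar (x ∷ w) (λ ())

length<ar?-f? : ∀ P Q → length P < ar? (f? (P ++ Q))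
length<ar?-f? P Q = subst (length P <_) (sym (ar?-f? (P ++ Q))) (s≤s (length-++-≤ˡ P))

f?-insert-min : ∀ P Q → All (z <_) (P ++ Q) →
                f? (P ++ z ∷ Q) ≡ just (f? (P ++ Q) ?∘[ suc (length P) ] two z)
f?-insert-min []      []      _  = refl
f?-insert-min []      (y ∷ Q) z< = cong just (f-insert-min [] (y ∷ Q) (λ ()) z<)
f?-insert-min (x ∷ P) Q       z< = cong just (f-insert-min (x ∷ P) Q (λ ()) z<)

-- f [] is the junk value two 0, which is not valid.
WF-f⇒≢[] : ∀ w → WF (f w) → w ≢ []
WF-f⇒≢[] w (() , _) refl

f-insert-min-≈I : ∀ P Q → 1 ≤ z → All (z <_) (P ++ Q) → f (P ++ Q) ≈I S →
                  f (P ++ z ∷ Q) ≈I S ∘[ suc (length P) ] two z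
f-insert-min-≈I {z} {S} P Q 1≤z z< f≈S =
  subst (_≈I S ∘[ suc (length P) ] two z) (sym (f-insert-min P Q P++Q≢[] z<))
        (∘-congˡ f≈S (graft-WF wf 1≤z (s≤s z≤n) pos≤ar z∉))
  where
  wf : WF (f (P ++ Q))
  wf = proj₁ (≈I-WF f≈S)
  P++Q≢[] : P ++ Q ≢ []
  P++Q≢[] = WF-f⇒≢[] (P ++ Q) wf
  pos≤ar : suc (length P) ≤ ar (f (P ++ Q))
  pos≤ar = subst (suc (length P) ≤_) (sym (f-ar (P ++ Q) P++Q≢[])) (s≤s (length-++-≤ˡ P))
  z∉ : All (z ≢_) (idx (f (P ++ Q)))
  z∉ = All.map <⇒≢ (All-resp-↭ (↭-sym (f-idx (P ++ Q) P++Q≢[])) z<)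

-- Decomposition at the largest letter

rootForm : ℕ → List ℕ → List ℕ → Term
rootForm κ aL aR = (two κ ∘?[ 2 ] f? aR) ∘?[ 1 ] f? aL

f≈rootForm-insertˡ : ∀ p q {κ aR} → 1 ≤ z → All (z <_) ((p ++ q) ++ κ ∷ aR) →
                     f ((p ++ q) ++ κ ∷ aR) ≈I rootForm κ (p ++ q) aR →
                     f ((p ++ z ∷ q) ++ κ ∷ aR) ≈I rootForm κ (p ++ z ∷ q) aR
f≈rootForm-insertˡ {z} p q {κ} {aR} 1≤z z< f≈rootForm
  rewrite f?-insert-min p q (All.++⁻ˡ (p ++ q) z<)
        | ++-assoc p q (κ ∷ aR) | ++-assoc p (z ∷ q) (κ ∷ aR)
  = ≈trans′ (f-insert-min-≈I p (q ++ κ ∷ aR) 1≤z z< f≈rootForm) (assoc1? (length<ar?-f? p q))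

f≈rootForm-insertʳ : ∀ aL p q {κ} → 1 ≤ z → All (z <_) (aL ++ κ ∷ p ++ q) →
                     f (aL ++ κ ∷ p ++ q) ≈I rootForm κ aL (p ++ q) →
                     f (aL ++ κ ∷ p ++ z ∷ q) ≈I rootForm κ aL (p ++ z ∷ q)
f≈rootForm-insertʳ {z} aL p q {κ} 1≤z z< f≈rootForm
  rewrite f?-insert-min p q (All.tail (All.++⁻ʳ aL z<))
        | sym (++-assoc aL (κ ∷ p) (z ∷ q)) | sym (++-assoc aL (κ ∷ p) q)
  = ≈trans′ (f-insert-min-≈I (aL ++ κ ∷ p) q 1≤z z< f≈rootForm)
            (graft-right position (length<ar?-f? p q))
  where
  position : suc (length (aL ++ κ ∷ p)) ≡ ar? (f? aL) + suc (length p)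
  position = trans (cong suc (length-++ aL)) (cong (_+ suc (length p)) (sym (ar?-f? aL)))

-- The hypotheses of the theorem on the letters of aL ++ aR, in a permutation-invariant form.
LettersBelow : ℕ → List ℕ → Set
LettersBelow κ ws = Unique ws × All (λ x → 1 ≤ x × x < κ) ws

remove-least : ∀ {κ ws ws′} → ws ↭ z ∷ ws′ → length ws ≡ suc n → All (z ≤_) ws →
               LettersBelow κ ws → length ws′ ≡ n × LettersBelow κ ws′ × All (z <_) ws′
remove-least σ len z≤ (u , bounds)
  with z∉ ∷ u′ ← Unique-resp-↭ σ u
     | _ ∷ bounds′ ← All-resp-↭ σ bounds
     | _ ∷ z≤′ ← All-resp-↭ σ z≤
  = suc-injective (trans (sym (↭-length σ)) len) , (u′ , bounds′) ,
    All.zipWith (uncurry ≤∧≢⇒<) (z≤′ , z∉)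

f≈rootForm′ : ∀ aL κ aR → length (aL ++ aR) ≡ n → 1 ≤ κ → LettersBelow κ (aL ++ aR) →
              f (aL ++ κ ∷ aR) ≈I rootForm κ aL aR
f≈rootForm′ {zero}  [] κ [] _   1≤κ _     = ≈refl (1≤κ , [] ∷ [])
f≈rootForm′ {suc n} aL κ aR len 1≤κ below
  with z , z∈ , z≤ ← least len
  with 1≤z , z<κ ← All.lookup (proj₂ below) z∈
  with ∈-++⁻ aL z∈
... | inj₁ z∈aL
  with p , q , refl ← ∈-∃++ z∈aL
  with len′ , below′ , z< ← remove-least (++⁺ʳ aR (shift z p q)) len z≤ below
  = f≈rootForm-insertˡ p q 1≤z (All-insert (p ++ q) z<κ z<)
                       (f≈rootForm′ (p ++ q) κ aR len′ 1≤κ below′)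
... | inj₂ z∈aR
  with p , q , refl ← ∈-∃++ z∈aR
  with len′ , below′ , z< ←
         remove-least (↭-trans (++⁺ˡ aL (shift z p q)) (shift z aL (p ++ q))) len z≤ below
  = f≈rootForm-insertʳ aL p q 1≤z (All-insert aL z<κ z<)
                       (f≈rootForm′ aL κ (p ++ q) len′ 1≤κ below′)

f≈rootForm : ∀ aL {κ} aR → Unique (aL ++ κ ∷ aR) → All (1 ≤_) (aL ++ κ ∷ aR) →
             All (_< κ) aL → All (_< κ) aR → f (aL ++ κ ∷ aR) ≈I rootForm κ aL aR
f≈rootForm aL {κ} aR u pos <κL <κR
  with _ ∷ u′ ← Unique-resp-↭ (shift κ aL aR) u | 1≤κ ∷ pos′ ← All-resp-↭ (shift κ aL aR) pos
  = f≈rootForm′ aL κ aR refl 1≤κ (u′ , All.zip (pos′ , All.++⁺ <κL <κR))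

lemma4p12 : (aL : List ℕ) (κ₁ : ℕ) (aR : List ℕ) →
    Unique (aL ++ κ₁ ∷ aR) → All (1 ≤_) (aL ++ κ₁ ∷ aR) →
    All (_< κ₁) aL → All (_< κ₁) aR →
    (BL BR : Term) → WF BL → WF BR →
    (aL ≢ [] → BL ≈I f aL) → (aR ≢ [] → BR ≈I f aR) →
    ((aL ≢ [] → aR ≢ [] →
        f (aL ++ κ₁ ∷ aR) ≈I (two κ₁ ∘[ 2 ] BR) ∘[ 1 ] BL)
     × (aL ≡ [] → aR ≢ [] → f (aL ++ κ₁ ∷ aR) ≈I two κ₁ ∘[ 2 ] BR)
     × (aR ≡ [] → aL ≢ [] → f (aL ++ κ₁ ∷ aR) ≈I two κ₁ ∘[ 1 ] BL)
     × (aL ≡ [] → aR ≡ [] → f (aL ++ κ₁ ∷ aR) ≡ two κ₁))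
lemma4p12 [] κ [] _ _ _ _ _ _ _ _ _ _ =
  (λ aL≢[] _ → contradiction refl aL≢[]) , (λ _ aR≢[] → contradiction refl aR≢[]) ,
  (λ _ aL≢[] → contradiction refl aL≢[]) , (λ _ _ → refl)
lemma4p12 [] κ aR@(_ ∷ _) u pos <κL <κR _ _ _ _ _ BR≈f =
  (λ aL≢[] _ → contradiction refl aL≢[]) ,
  (λ _ _ → ≈trans′ (f≈rootForm [] aR u pos <κL <κR) (∘-congʳ (≈sym (BR≈f (λ ()))))) ,
  (λ ()) , (λ _ ())
lemma4p12 aL@(_ ∷ _) κ [] u pos <κL <κR _ _ _ _ BL≈f _ =
  (λ _ aR≢[] → contradiction refl aR≢[]) , (λ ()) ,
  (λ _ _ → ≈trans′ (f≈rootForm aL [] u pos <κL <κR) (∘-congʳ (≈sym (BL≈f (λ ()))))) ,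
  (λ ())
lemma4p12 aL@(_ ∷ _) κ aR@(_ ∷ _) u pos <κL <κR _ _ _ _ BL≈f BR≈f =
  (λ _ _ → ≈trans′ (f≈rootForm aL aR u pos <κL <κR) λ w →
     ∘-cong (∘-congʳ (≈sym (BR≈f (λ ()))) (WF-∘ˡ w)) (≈sym (BL≈f (λ ()))) w) ,
  (λ ()) , (λ ()) , (λ ())
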